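{- Let $S$ be a set. Gray comonoid structures $(\Sigma[S],d_S,e_S)$ on the 2-category $\Sigma[S]$ are in bijective correspondence with polarity functions $\lambda_S:S\to\{O,P\}$: under this correspondence the comultiplication $d_S:\Sigma[S]\to\Sigma[S]\boxtimes\Sigma[S]\cong\Sigma[S+S]$ sends a generator $s\in S$ to the 1-cell $s^{(1)}\cdot s^{(2)}$ when $\lambda_S(s)=P$ and to $s^{(2)}\cdot s^{(1)}$ when $\lambda_S(s)=O$, where $s^{(1)},s^{(2)}$ denote the copies of $s$ in the first and second factor.
   Context: For a set $L$, $\Sigma[L]$ denotes the 2-category with a single object $\ast$, whose 1-cells $\ast\to\ast$ are the finite words over $L$ (composition is concatenation, written $w\cdot w'$ for "first $w$ then $w'$"; identity is the empty word), and whose 2-cells from $\ell_1\cdots\ell_k$ to $\ell'_1\cdots\ell'_k$ are the bijections $\varphi$ of $\{1,\dots,k\}$ with $\ell'_{\varphi(i)}=\ell_i$ for all $i$ (no 2-cells between words of different lengths), with vertical composition given by composition of bijections and horizontal composition by juxtaposition; i.e. the free strict symmetric monoidal category on $L$ seen as a one-object 2-category. Gray tensor product: for 2-categories $\mathscr A,\mathscr B$, $\mathscr A\boxtimes\mathscr B$ has objects pairs $(A,B)$; its 1-cells are generated by $(a,B):(A,B)\to(A',B)$ for 1-cells $a:A\to A'$ of $\mathscr A$ and $(A,b):(A,B)\to(A,B')$ for 1-cells $b:B\to B'$ of $\mathscr B$, subject only to $(a,B)\cdot(a',B)=(a'\circ a,B)$, $(\mathrm{id}_A,B)=\mathrm{id}$,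 $(A,b)\cdot(A,b')=(A,b'\circ b)$, $(A,\mathrm{id}_B)=\mathrm{id}$ (the funny tensor product of the underlying categories); a 2-cell $f\Rightarrow g$ between 1-cells $f,g:(A,B)\to(A',B')$ is a pair of a 2-cell $\pi_1f\Rightarrow\pi_1g$ in $\mathscr A$ and a 2-cell $\pi_2f\Rightarrow\pi_2g$ in $\mathscr B$, where $\pi_1,\pi_2$ project 1-cells to $\mathscr A$ and $\mathscr B$ (sending generators of the other variable to identities), with componentwise compositions. This makes the category $\mathbf{2}\text{ - }\mathbf{Cat}$ of small 2-categories and 2-functors symmetric monoidal with unit the terminal 2-category $\mathbf 1$; one has $\Sigma[L_1]\boxtimes\Sigma[L_2]\cong\Sigma[L_1+L_2]$. A Gray comonoid is a comonoid $(A,d,e)$ in $(\mathbf{2}\text{ - }\mathbf{Cat},\boxtimes,\mathbf 1)$: 2-functors $d:A\to A\boxtimes A$, $e:A\to\mathbf 1$ that are coassociative and counital. -}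

module Defs where

open import Data.Empty using (⊥)
open import Data.Unit using (⊤; tt)
open import Data.Sum as Sum using (_⊎_; inj₁; inj₂)
open import Data.Product using (Σ; _×_; _,_; proj₁; proj₂)
open import Data.List using (List; []; _∷_; _++_; length; lookup; map)
open import Data.Fin using (Fin; zero; suc)
open import Relation.Binary.PropositionalEquality

-- One-object 2-categories whose 1-cells are the finite words over a set
-- of generators (composition = concatenation "first w then w'",
-- identity = empty word).  2-cells are an arbitrary family with an
-- equality (setoid) relation, identities, vertical composition
-- (diagrammatic order: α ∙ β = "first α then β") and horizontal
-- composition (juxtaposition).  Σ[S], the terminal 2-category 𝟏, and all
-- Gray tensor products of these are of this form.

record Free2 : Set₁ where
  infixr 9 _∙_
  infixr 8 _⊗_
  field
    Gen  : Set
    Cell : List Gen → List Gen → Set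
    _≈_  : ∀ {u v} → Cell u v → Cell u v → Set
    idC  : ∀ u → Cell u u
    _∙_  : ∀ {u v w} → Cell u v → Cell v w → Cell u w
    _⊗_  : ∀ {u v u' v'} → Cell u v → Cell u' v' → Cell (u ++ u') (v ++ v')

module _ {S : Set} where

  joinL : (u u' : List S) → Fin (length u) → Fin (length (u ++ u'))
  joinL (x ∷ u) u' zero    = zero
  joinL (x ∷ u) u' (suc i) = suc (joinL u u' i)

  joinR : (u u' : List S) → Fin (length u') → Fin (length (u ++ u'))
  joinR []      u' j = j
  joinR (x ∷ u) u' j = suc (joinR u u' j)

  join : (u u' : List S) → Fin (length u) ⊎ Fin (length u') → Fin (length (u ++ u'))
  join u u' (inj₁ i) = joinL u u' i
  join u u' (inj₂ j) = joinR u u' j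

  split : (u u' : List S) → Fin (length (u ++ u')) → Fin (length u) ⊎ Fin (length u')
  split []      u' i       = inj₂ i
  split (x ∷ u) u' zero    = inj₁ zero
  split (x ∷ u) u' (suc i) = Sum.map₁ suc (split u u' i)

  split-join : (u u' : List S) (s : Fin (length u) ⊎ Fin (length u')) → split u u' (join u u' s) ≡ s
  split-join []      u' (inj₂ j)       = refl
  split-join (x ∷ u) u' (inj₁ zero)    = refl
  split-join (x ∷ u) u' (inj₁ (suc i)) = cong (Sum.map₁ suc) (split-join u u' (inj₁ i))
  split-join (x ∷ u) u' (inj₂ j)       = cong (Sum.map₁ suc) (split-join u u' (inj₂ j))

  join-split : (u u' : List S) (i : Fin (length (u ++ u'))) → join u u' (split u u' i) ≡ i
  join-split []      u' i       = refl
  join-split (x ∷ u) u' zero    = refl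
  join-split (x ∷ u) u' (suc i) with split u u' i | join-split u u' i
  ... | inj₁ k | p = cong suc p
  ... | inj₂ k | p = cong suc p

  lookup-join : (u u' : List S) (s : Fin (length u) ⊎ Fin (length u')) →
                lookup (u ++ u') (join u u' s) ≡ Sum.[ lookup u , lookup u' ] s
  lookup-join []      u' (inj₂ j)       = refl
  lookup-join (x ∷ u) u' (inj₁ zero)    = refl
  lookup-join (x ∷ u) u' (inj₁ (suc i)) = lookup-join u u' (inj₁ i)
  lookup-join (x ∷ u) u' (inj₂ j)       = lookup-join u u' (inj₂ j)

-- 2-cells of Σ[S]: bijections of positions preserving labels
-- (ℓ'_{φ(i)} = ℓ_i).  Two 2-cells are equal iff their underlying
-- bijections agree.

record Perm {S : Set} (u v : List S) : Set where
  field
    to      : Fin (length u) → Fin (length v)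
    from    : Fin (length v) → Fin (length u)
    to-from : ∀ j → to (from j) ≡ j
    from-to : ∀ i → from (to i) ≡ i
    lab     : ∀ i → lookup v (to i) ≡ lookup u i
open Perm public

module _ {S : Set} where

  _≈P_ : {u v : List S} → Perm u v → Perm u v → Set
  α ≈P β = ∀ i → to α i ≡ to β i

  idP : (u : List S) → Perm u u
  idP u = record { to = λ i → i ; from = λ i → i ; to-from = λ _ → refl ; from-to = λ _ → refl ; lab = λ _ → refl }

  _∙P_ : {u v w : List S} → Perm u v → Perm v w → Perm u w
  α ∙P β = record
    { to      = λ i → to β (to α i)
    ; from    = λ k → from α (from β k)
    ; to-from = λ k → trans (cong (to β) (to-from α (from β k))) (to-from β k)
    ; from-to = λ i → trans (cong (from α) (from-to β (to α i))) (from-to α i)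
    ; lab     = λ i → trans (lab β (to α i)) (lab α i)
    }

  _⊗P_ : {u v u' v' : List S} → Perm u v → Perm u' v' → Perm (u ++ u') (v ++ v')
  _⊗P_ {u} {v} {u'} {v'} α β = record
    { to      = λ i → join v v' (Sum.map (to α) (to β) (split u u' i))
    ; from    = λ j → join u u' (Sum.map (from α) (from β) (split v v' j))
    ; to-from = λ j → trans (cong (λ s → join v v' (Sum.map (to α) (to β) s))
                                  (split-join u u' (Sum.map (from α) (from β) (split v v' j))))
                       (trans (cong (join v v') (tf (split v v' j))) (join-split v v' j))
    ; from-to = λ i → trans (cong (λ s → join u u' (Sum.map (from α) (from β) s))
                                  (split-join v v' (Sum.map (to α) (to β) (split u u' i))))
                       (trans (cong (join u u') (ft (split u u' i))) (join-split u u' i))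
    ; lab     = λ i → trans (labS (split u u' i)) (cong (lookup (u ++ u')) (join-split u u' i))
    }
    where
    tf : ∀ s → Sum.map (to α) (to β) (Sum.map (from α) (from β) s) ≡ s
    tf (inj₁ x) = cong inj₁ (to-from α x)
    tf (inj₂ y) = cong inj₂ (to-from β y)
    ft : ∀ s → Sum.map (from α) (from β) (Sum.map (to α) (to β) s) ≡ s
    ft (inj₁ x) = cong inj₁ (from-to α x)
    ft (inj₂ y) = cong inj₂ (from-to β y)
    labS : ∀ s → lookup (v ++ v') (join v v' (Sum.map (to α) (to β) s)) ≡ lookup (u ++ u') (join u u' s)
    labS (inj₁ k) = trans (lookup-join v v' (inj₁ (to α k)))
                     (trans (lab α k) (sym (lookup-join u u' (inj₁ k))))
    labS (inj₂ k) = trans (lookup-join v v' (inj₂ (to β k)))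
                     (trans (lab β k) (sym (lookup-join u u' (inj₂ k))))

-- Σ[S]: the free strict symmetric monoidal category on S, as a
-- one-object 2-category.
Σ[_] : Set → Free2
Σ[ S ] = record
  { Gen = S ; Cell = Perm ; _≈_ = _≈P_ ; idC = idP ; _∙_ = _∙P_ ; _⊗_ = _⊗P_ }

𝟏 : Free2
𝟏 = record
  { Gen = ⊥ ; Cell = λ _ _ → ⊤ ; _≈_ = λ _ _ → ⊤ ; idC = λ _ → tt
  ; _∙_ = λ _ _ → tt ; _⊗_ = λ _ _ → tt }

module _ {A B : Set} where

  π₁ : List (A ⊎ B) → List A
  π₁ []           = []
  π₁ (inj₁ a ∷ u) = a ∷ π₁ u
  π₁ (inj₂ b ∷ u) = π₁ u

  π₂ : List (A ⊎ B) → List B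
  π₂ []           = []
  π₂ (inj₁ a ∷ u) = π₂ u
  π₂ (inj₂ b ∷ u) = b ∷ π₂ u

  π₁-++ : ∀ u u' → π₁ (u ++ u') ≡ π₁ u ++ π₁ u'
  π₁-++ []           u' = refl
  π₁-++ (inj₁ a ∷ u) u' = cong (a ∷_) (π₁-++ u u')
  π₁-++ (inj₂ b ∷ u) u' = π₁-++ u u'

  π₂-++ : ∀ u u' → π₂ (u ++ u') ≡ π₂ u ++ π₂ u'
  π₂-++ []           u' = refl
  π₂-++ (inj₁ a ∷ u) u' = π₂-++ u u'
  π₂-++ (inj₂ b ∷ u) u' = cong (b ∷_) (π₂-++ u u')

  π₁-inj₁ : ∀ (x : List A) → π₁ (map inj₁ x) ≡ x
  π₁-inj₁ []      = refl
  π₁-inj₁ (a ∷ x) = cong (a ∷_) (π₁-inj₁ x)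

  π₁-inj₂ : ∀ (y : List B) → π₁ (map inj₂ y) ≡ []
  π₁-inj₂ []      = refl
  π₁-inj₂ (b ∷ y) = π₁-inj₂ y

  π₂-inj₁ : ∀ (x : List A) → π₂ (map inj₁ x) ≡ []
  π₂-inj₁ []      = refl
  π₂-inj₁ (a ∷ x) = π₂-inj₁ x

  π₂-inj₂ : ∀ (y : List B) → π₂ (map inj₂ y) ≡ y
  π₂-inj₂ []      = refl
  π₂-inj₂ (b ∷ y) = cong (b ∷_) (π₂-inj₂ y)

-- Gray tensor product (of one-object 2-categories with free 1-cells):
-- 1-cells are words over the disjoint union of generators (funny tensor
-- product), a 2-cell f ⇒ g is a pair of 2-cells π₁f ⇒ π₁g and π₂f ⇒ π₂g.

_⊠_ : Free2 → Free2 → Free2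
𝒜 ⊠ ℬ = record
  { Gen  = A.Gen ⊎ B.Gen
  ; Cell = λ u v → A.Cell (π₁ u) (π₁ v) × B.Cell (π₂ u) (π₂ v)
  ; _≈_  = λ p q → (proj₁ p A.≈ proj₁ q) × (proj₂ p B.≈ proj₂ q)
  ; idC  = λ u → A.idC (π₁ u) , B.idC (π₂ u)
  ; _∙_  = λ p q → (proj₁ p A.∙ proj₁ q) , (proj₂ p B.∙ proj₂ q)
  ; _⊗_  = λ {u} {v} {u'} {v'} p q →
      subst₂ A.Cell (sym (π₁-++ u u')) (sym (π₁-++ v v')) (proj₁ p A.⊗ proj₁ q) ,
      subst₂ B.Cell (sym (π₂-++ u u')) (sym (π₂-++ v v')) (proj₂ p B.⊗ proj₂ q)
  }
  where
  module A = Free2 𝒜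
  module B = Free2 ℬ

record Map (𝒜 ℬ : Free2) : Set where
  field
    M₁ : List (Free2.Gen 𝒜) → List (Free2.Gen ℬ)
    M₂ : ∀ {u v} → Free2.Cell 𝒜 u v → Free2.Cell ℬ (M₁ u) (M₁ v)
open Map public

record TwoFunctor (𝒜 ℬ : Free2) : Set where
  field
    F₁    : List (Free2.Gen 𝒜) → List (Free2.Gen ℬ)
    F₁-ε  : F₁ [] ≡ []
    F₁-·  : ∀ u u' → F₁ (u ++ u') ≡ F₁ u ++ F₁ u'
    F₂    : ∀ {u v} → Free2.Cell 𝒜 u v → Free2.Cell ℬ (F₁ u) (F₁ v)
    F₂-cong : ∀ {u v} {α β : Free2.Cell 𝒜 u v} →
              Free2._≈_ 𝒜 α β → Free2._≈_ ℬ (F₂ α) (F₂ β)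
    F₂-id : ∀ u → Free2._≈_ ℬ (F₂ (Free2.idC 𝒜 u)) (Free2.idC ℬ (F₁ u))
    F₂-∙  : ∀ {u v w} (α : Free2.Cell 𝒜 u v) (β : Free2.Cell 𝒜 v w) →
            Free2._≈_ ℬ (F₂ (Free2._∙_ 𝒜 α β)) (Free2._∙_ ℬ (F₂ α) (F₂ β))
    F₂-⊗  : ∀ {u v u' v'} (α : Free2.Cell 𝒜 u v) (β : Free2.Cell 𝒜 u' v') →
            Free2._≈_ ℬ (subst₂ (Free2.Cell ℬ) (F₁-· u u') (F₁-· v v') (F₂ (Free2._⊗_ 𝒜 α β)))
                        (Free2._⊗_ ℬ (F₂ α) (F₂ β))
open TwoFunctor public

toMap : ∀ {𝒜 ℬ} → TwoFunctor 𝒜 ℬ → Map 𝒜 ℬ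
toMap F = record { M₁ = F₁ F ; M₂ = F₂ F }

_≐_ : ∀ {𝒜 ℬ} → Map 𝒜 ℬ → Map 𝒜 ℬ → Set
_≐_ {𝒜} {ℬ} F G =
  Σ (∀ u → M₁ F u ≡ M₁ G u) λ p →
    ∀ {u v} (α : Free2.Cell 𝒜 u v) →
      Free2._≈_ ℬ (subst₂ (Free2.Cell ℬ) (p u) (p v) (M₂ F α)) (M₂ G α)

idM : ∀ {𝒜} → Map 𝒜 𝒜
idM = record { M₁ = λ u → u ; M₂ = λ α → α }

_∘M_ : ∀ {𝒜 ℬ 𝒞} → Map ℬ 𝒞 → Map 𝒜 ℬ → Map 𝒜 𝒞
G ∘M F = record { M₁ = λ u → M₁ G (M₁ F u) ; M₂ = λ α → M₂ G (M₂ F α) }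

module _ {𝒜 𝒜' ℬ ℬ'} (F : TwoFunctor 𝒜 𝒜') (G : TwoFunctor ℬ ℬ') where

  tens₁ : List (Free2.Gen 𝒜 ⊎ Free2.Gen ℬ) → List (Free2.Gen 𝒜' ⊎ Free2.Gen ℬ')
  tens₁ []           = []
  tens₁ (inj₁ a ∷ u) = map inj₁ (F₁ F (a ∷ [])) ++ tens₁ u
  tens₁ (inj₂ b ∷ u) = map inj₂ (F₁ G (b ∷ [])) ++ tens₁ u

  π₁-tens : ∀ u → π₁ (tens₁ u) ≡ F₁ F (π₁ u)
  π₁-tens [] = sym (F₁-ε F)
  π₁-tens (inj₁ a ∷ u) =
    trans (π₁-++ (map inj₁ (F₁ F (a ∷ []))) (tens₁ u))
      (trans (cong₂ _++_ (π₁-inj₁ (F₁ F (a ∷ []))) (π₁-tens u))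
        (sym (F₁-· F (a ∷ []) (π₁ u))))
  π₁-tens (inj₂ b ∷ u) =
    trans (π₁-++ (map inj₂ (F₁ G (b ∷ []))) (tens₁ u))
      (trans (cong (_++ π₁ (tens₁ u)) (π₁-inj₂ (F₁ G (b ∷ [])))) (π₁-tens u))

  π₂-tens : ∀ u → π₂ (tens₁ u) ≡ F₁ G (π₂ u)
  π₂-tens [] = sym (F₁-ε G)
  π₂-tens (inj₁ a ∷ u) =
    trans (π₂-++ (map inj₁ (F₁ F (a ∷ []))) (tens₁ u))
      (trans (cong (_++ π₂ (tens₁ u)) (π₂-inj₁ (F₁ F (a ∷ [])))) (π₂-tens u))
  π₂-tens (inj₂ b ∷ u) =
    trans (π₂-++ (map inj₂ (F₁ G (b ∷ []))) (tens₁ u))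
      (trans (cong₂ _++_ (π₂-inj₂ (F₁ G (b ∷ []))) (π₂-tens u))
        (sym (F₁-· G (b ∷ []) (π₂ u))))

  _⊠F_ : Map (𝒜 ⊠ ℬ) (𝒜' ⊠ ℬ')
  _⊠F_ = record
    { M₁ = tens₁
    ; M₂ = λ {u} {v} p →
        subst₂ (Free2.Cell 𝒜') (sym (π₁-tens u)) (sym (π₁-tens v)) (F₂ F (proj₁ p)) ,
        subst₂ (Free2.Cell ℬ') (sym (π₂-tens u)) (sym (π₂-tens v)) (F₂ G (proj₂ p))
    }

module _ {A B C : Set} where

  reassoc : (A ⊎ B) ⊎ C → A ⊎ (B ⊎ C)
  reassoc (inj₁ (inj₁ a)) = inj₁ a
  reassoc (inj₁ (inj₂ b)) = inj₂ (inj₁ b)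
  reassoc (inj₂ c)        = inj₂ (inj₂ c)

  r₁ : ∀ u → π₁ (map reassoc u) ≡ π₁ (π₁ u)
  r₁ []                    = refl
  r₁ (inj₁ (inj₁ a) ∷ u)   = cong (a ∷_) (r₁ u)
  r₁ (inj₁ (inj₂ b) ∷ u)   = r₁ u
  r₁ (inj₂ c ∷ u)          = r₁ u

  r₂ : ∀ u → π₁ (π₂ (map reassoc u)) ≡ π₂ (π₁ u)
  r₂ []                    = refl
  r₂ (inj₁ (inj₁ a) ∷ u)   = r₂ u
  r₂ (inj₁ (inj₂ b) ∷ u)   = cong (b ∷_) (r₂ u)
  r₂ (inj₂ c ∷ u)          = r₂ u

  r₃ : ∀ u → π₂ (π₂ (map reassoc u)) ≡ π₂ u
  r₃ []                    = refl
  r₃ (inj₁ (inj₁ a) ∷ u)   = r₃ u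
  r₃ (inj₁ (inj₂ b) ∷ u)   = r₃ u
  r₃ (inj₂ c ∷ u)          = cong (c ∷_) (r₃ u)

assocM : ∀ {𝒜 ℬ 𝒞} → Map ((𝒜 ⊠ ℬ) ⊠ 𝒞) (𝒜 ⊠ (ℬ ⊠ 𝒞))
assocM {𝒜} {ℬ} {𝒞} = record
  { M₁ = map reassoc
  ; M₂ = λ {u} {v} p →
      subst₂ (Free2.Cell 𝒜) (sym (r₁ u)) (sym (r₁ v)) (proj₁ (proj₁ p)) ,
      (subst₂ (Free2.Cell ℬ) (sym (r₂ u)) (sym (r₂ v)) (proj₂ (proj₁ p)) ,
       subst₂ (Free2.Cell 𝒞) (sym (r₃ u)) (sym (r₃ v)) (proj₂ p))
  }

unitˡ : ∀ {𝒜} → Map (𝟏 ⊠ 𝒜) 𝒜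
unitˡ = record { M₁ = π₂ ; M₂ = proj₂ }

unitʳ : ∀ {𝒜} → Map (𝒜 ⊠ 𝟏) 𝒜
unitʳ = record { M₁ = π₁ ; M₂ = proj₁ }

idTF : (S : Set) → TwoFunctor Σ[ S ] Σ[ S ]
idTF S = record
  { F₁ = λ u → u ; F₁-ε = refl ; F₁-· = λ _ _ → refl ; F₂ = λ α → α
  ; F₂-cong = λ p → p ; F₂-id = λ _ _ → refl ; F₂-∙ = λ _ _ _ → refl
  ; F₂-⊗ = λ _ _ _ → refl }

record GrayComonoid (S : Set) : Set where
  field
    d : TwoFunctor Σ[ S ] (Σ[ S ] ⊠ Σ[ S ])
    e : TwoFunctor Σ[ S ] 𝟏
    coassoc : (assocM {Σ[ S ]} {Σ[ S ]} {Σ[ S ]} ∘M ((d ⊠F idTF S) ∘M toMap d)) ≐ ((idTF S ⊠F d) ∘M toMap d)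
    counitˡ : (unitˡ ∘M ((e ⊠F idTF S) ∘M toMap d)) ≐ idM
    counitʳ : (unitʳ ∘M ((idTF S ⊠F e) ∘M toMap d)) ≐ idM
open GrayComonoid public

_≐C_ : ∀ {S} → GrayComonoid S → GrayComonoid S → Set
c ≐C c' = (toMap (d c) ≐ toMap (d c')) × (toMap (e c) ≐ toMap (e c'))

data Pol : Set where
  O P : Pol

polGen : {S : Set} → Pol → S → List (S ⊎ S)
polGen P s = inj₁ s ∷ inj₂ s ∷ []
polGen O s = inj₂ s ∷ inj₁ s ∷ []

Corresponds : {S : Set} → GrayComonoid S → (S → Pol) → Set
Corresponds {S} c λS = ∀ (s : S) → F₁ (d c) (s ∷ []) ≡ polGen (λS s) s

{-# OPTIONS --safe #-}
module Submission where

open import Defs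
open import Data.Empty using (⊥)
open import Data.Unit using (tt)
open import Data.Product using (Σ; _×_; _,_; proj₁; proj₂)
open import Data.Sum using (_⊎_; inj₁; inj₂)
import Data.Sum.Properties as Sum
open import Data.List using (List; []; _∷_; _++_; map)
open import Data.List.Properties using (++-assoc; ++-identityʳ; map-++)
open import Relation.Binary.PropositionalEquality
open import Function using (_∘_)

-- The counit laws say that projecting d(w) to either factor gives back w, on
-- 1-cells and on 2-cells.  On a generator s this leaves only the two words
-- s⁽¹⁾s⁽²⁾ and s⁽²⁾s⁽¹⁾, which is the polarity of s; since d is strict
-- monoidal on words and its action on 2-cells is forced by the counit laws,
-- d is determined by the polarity, and e is unique because 𝟏 has only the
-- empty word.  Conversely a polarity defines a word map with both
-- projections the identity; it extends to 2-cells by transporting a 2-cell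
-- into each factor, the counit laws hold by construction, and
-- coassociativity reduces to a check on single generators.

module _ {L : Set} where

  ≈P-refl : {u v : List L} (α : Perm u v) → α ≈P α
  ≈P-refl α i = refl

  ≈P-sym : {u v : List L} {α β : Perm u v} → α ≈P β → β ≈P α
  ≈P-sym e i = sym (e i)

  ≈P-trans : {u v : List L} {α β γ : Perm u v} → α ≈P β → β ≈P γ → α ≈P γ
  ≈P-trans e e′ i = trans (e i) (e′ i)

  ∙P-cong : {u v w : List L} {α α′ : Perm u v} {β β′ : Perm v w} →
            α ≈P α′ → β ≈P β′ → (α ∙P β) ≈P (α′ ∙P β′)
  ∙P-cong {β′ = β′} e e′ i = trans (e′ _) (cong (to β′) (e i))

  ⊗P-cong : {u v u′ v′ : List L} {α α′ : Perm u v} {β β′ : Perm u′ v′} →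
            α ≈P α′ → β ≈P β′ → (α ⊗P β) ≈P (α′ ⊗P β′)
  ⊗P-cong {u} {v} {u′} {v′} e e′ i = cong (join v v′) (Sum.map-cong e e′ (split u u′ i))

  -- Equality of 2-cells whose boundaries are only propositionally equal, as
  -- happens after the transports built into ⊠ and ⊠F; matching on it uses K.
  -- Since _≈P_ does not determine the 2-cells it compares, chains ending in
  -- ≅P⇒≈P sometimes need the transport proofs of subst₂-≅P given explicitly.
  infix 4 _≅P_
  data _≅P_ {u v : List L} (α : Perm u v) : {u′ v′ : List L} → Perm u′ v′ → Set where
    ≈P⇒≅P : {β : Perm u v} → α ≈P β → α ≅P β

  ≅P⇒≈P : {u v : List L} {α β : Perm u v} → α ≅P β → α ≈P β
  ≅P⇒≈P (≈P⇒≅P e) = e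

  ≅P-refl : {u v : List L} {α : Perm u v} → α ≅P α
  ≅P-refl {α = α} = ≈P⇒≅P (≈P-refl α)

  ≅P-sym : {u v u′ v′ : List L} {α : Perm u v} {β : Perm u′ v′} → α ≅P β → β ≅P α
  ≅P-sym {α = α} {β} (≈P⇒≅P e) = ≈P⇒≅P (≈P-sym {α = α} {β} e)

  infixr 5 _⨾_
  _⨾_ : {u v u′ v′ u″ v″ : List L} {α : Perm u v} {β : Perm u′ v′} {γ : Perm u″ v″} →
        α ≅P β → β ≅P γ → α ≅P γ
  _⨾_ {α = α} {β} {γ} (≈P⇒≅P e) (≈P⇒≅P e′) = ≈P⇒≅P (≈P-trans {α = α} {β} {γ} e e′)

  subst₂-≅P : {u v u′ v′ : List L} {p : u ≡ u′} {q : v ≡ v′} {α : Perm u v} →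
              subst₂ (Free2.Cell Σ[ L ]) p q α ≅P α
  subst₂-≅P {p = refl} {refl} = ≅P-refl

  idP-≅P : {u u′ : List L} → u ≡ u′ → idP u ≅P idP u′
  idP-≅P refl = ≅P-refl

  ∙P-≅P : {u v w u′ v′ w′ : List L} {α : Perm u v} {β : Perm v w} {α′ : Perm u′ v′} {β′ : Perm v′ w′} →
          α ≅P α′ → β ≅P β′ → α ∙P β ≅P α′ ∙P β′
  ∙P-≅P {α = α} {β} {α′} {β′} (≈P⇒≅P e) (≈P⇒≅P e′) = ≈P⇒≅P (∙P-cong {α = α} {α′} {β} {β′} e e′)

  ⊗P-≅P : {u v u′ v′ x y x′ y′ : List L} {α : Perm u v} {β : Perm u′ v′} {α′ : Perm x y} {β′ : Perm x′ y′} →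
          α ≅P α′ → β ≅P β′ → α ⊗P β ≅P α′ ⊗P β′
  ⊗P-≅P {α = α} {β} {α′} {β′} (≈P⇒≅P e) (≈P⇒≅P e′) = ≈P⇒≅P (⊗P-cong {α = α} {α′} {β} {β′} e e′)

  ≐⇒≅P : {𝒜 : Free2} {F G : Map 𝒜 Σ[ L ]} → F ≐ G →
         {u v : List (Free2.Gen 𝒜)} (α : Free2.Cell 𝒜 u v) → M₂ F α ≅P M₂ G α
  ≐⇒≅P (same-M₁ , same-M₂) {u} {v} α =
    ≅P-sym (subst₂-≅P {p = same-M₁ u} {same-M₁ v}) ⨾ ≈P⇒≅P (same-M₂ α)

  component-subst₂-≅P : {X : Set} {C : List X → List X → Set} {f g : List X → List L}
    (component : ∀ {a b} → C a b → Perm (f a) (g b)) {u v u′ v′ : List X}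
    (p : u ≡ u′) (q : v ≡ v′) (c : C u v) → component (subst₂ C p q c) ≅P component c
  component-subst₂-≅P component refl refl c = ≅P-refl

F₁-determined-by-generators : {𝒜 𝒞 : Free2} (F G : TwoFunctor 𝒜 𝒞) →
  (∀ a → F₁ F (a ∷ []) ≡ F₁ G (a ∷ [])) → ∀ u → F₁ F u ≡ F₁ G u
F₁-determined-by-generators F G agree [] = trans (F₁-ε F) (sym (F₁-ε G))
F₁-determined-by-generators F G agree (a ∷ u) = begin
  F₁ F (a ∷ u)                ≡⟨ F₁-· F (a ∷ []) u ⟩
  F₁ F (a ∷ []) ++ F₁ F u     ≡⟨ cong₂ _++_ (agree a) (F₁-determined-by-generators F G agree u) ⟩
  F₁ G (a ∷ []) ++ F₁ G u     ≡⟨ F₁-· G (a ∷ []) u ⟨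
  F₁ G (a ∷ u)                ∎
  where open ≡-Reasoning

⊥-words-equal : (x y : List ⊥) → x ≡ y
⊥-words-equal []      []      = refl
⊥-words-equal []      (() ∷ _)
⊥-words-equal (() ∷ _) _

tens₁-++ : {𝒜 𝒜′ ℬ ℬ′ : Free2} (F : TwoFunctor 𝒜 𝒜′) (G : TwoFunctor ℬ ℬ′)
           (w w′ : List (Free2.Gen 𝒜 ⊎ Free2.Gen ℬ)) → tens₁ F G (w ++ w′) ≡ tens₁ F G w ++ tens₁ F G w′
tens₁-++ F G []           w′ = refl
tens₁-++ F G (inj₁ a ∷ w) w′ = trans (cong (map inj₁ (F₁ F (a ∷ [])) ++_) (tens₁-++ F G w w′))
                                     (sym (++-assoc (map inj₁ (F₁ F (a ∷ []))) _ _))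
tens₁-++ F G (inj₂ b ∷ w) w′ = trans (cong (map inj₂ (F₁ G (b ∷ [])) ++_) (tens₁-++ F G w w′))
                                     (sym (++-assoc (map inj₂ (F₁ G (b ∷ []))) _ _))

terminalTF : {𝒜 : Free2} → TwoFunctor 𝒜 𝟏
terminalTF = record
  { F₁ = λ _ → [] ; F₁-ε = refl ; F₁-· = λ _ _ → refl ; F₂ = λ _ → tt
  ; F₂-cong = λ _ → tt ; F₂-id = λ _ → tt ; F₂-∙ = λ _ _ → tt ; F₂-⊗ = λ _ _ → tt }

module _ {S : Set} where

  polGen-injective : {p p′ : Pol} {s : S} → polGen p s ≡ polGen p′ s → p ≡ p′
  polGen-injective {O} {O} _ = refl
  polGen-injective {P} {P} _ = refl

  polGen-from-projections : (w : List (S ⊎ S)) {s : S} →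
    π₁ w ≡ s ∷ [] → π₂ w ≡ s ∷ [] → Σ Pol λ p → w ≡ polGen p s
  polGen-from-projections (inj₁ a ∷ inj₂ b ∷ []) refl refl = P , refl
  polGen-from-projections (inj₂ b ∷ inj₁ a ∷ []) refl refl = O , refl
  polGen-from-projections []                         () _
  polGen-from-projections (inj₁ _ ∷ [])              _  ()
  polGen-from-projections (inj₂ _ ∷ [])              () _
  polGen-from-projections (inj₁ _ ∷ inj₁ _ ∷ _)      () _
  polGen-from-projections (inj₂ _ ∷ inj₂ _ ∷ _)      _  ()
  polGen-from-projections (inj₁ _ ∷ inj₂ _ ∷ inj₁ _ ∷ _) () _
  polGen-from-projections (inj₁ _ ∷ inj₂ _ ∷ inj₂ _ ∷ _) _  ()
  polGen-from-projections (inj₂ _ ∷ inj₁ _ ∷ inj₁ _ ∷ _) () _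
  polGen-from-projections (inj₂ _ ∷ inj₁ _ ∷ inj₂ _ ∷ _) _  ()

  π₁-polGen-++ : (p : Pol) (s : S) (w : List (S ⊎ S)) → π₁ (polGen p s ++ w) ≡ s ∷ π₁ w
  π₁-polGen-++ O s w = refl
  π₁-polGen-++ P s w = refl

  π₂-polGen-++ : (p : Pol) (s : S) (w : List (S ⊎ S)) → π₂ (polGen p s ++ w) ≡ s ∷ π₂ w
  π₂-polGen-++ O s w = refl
  π₂-polGen-++ P s w = refl

Cell² : (S : Set) → List (S ⊎ S) → List (S ⊎ S) → Set
Cell² S = Free2.Cell (Σ[ S ] ⊠ Σ[ S ])

module _ {S : Set} (c : GrayComonoid S) where

  π₁-d : ∀ u → π₁ (F₁ (d c) u) ≡ u
  π₁-d u = trans (sym (π₁-tens (idTF S) (e c) (F₁ (d c) u))) (proj₁ (counitʳ c) u)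

  π₂-d : ∀ u → π₂ (F₁ (d c) u) ≡ u
  π₂-d u = trans (sym (π₂-tens (e c) (idTF S) (F₁ (d c) u))) (proj₁ (counitˡ c) u)

  proj₁-d-≅P : {u v : List S} (α : Perm u v) → proj₁ (F₂ (d c) α) ≅P α
  proj₁-d-≅P α = ≅P-sym subst₂-≅P ⨾ ≐⇒≅P {G = idM} (counitʳ c) α

  proj₂-d-≅P : {u v : List S} (α : Perm u v) → proj₂ (F₂ (d c) α) ≅P α
  proj₂-d-≅P α = ≅P-sym subst₂-≅P ⨾ ≐⇒≅P {G = idM} (counitˡ c) α

  d-generator-shape : (s : S) → Σ Pol λ p → F₁ (d c) (s ∷ []) ≡ polGen p s
  d-generator-shape s = polGen-from-projections (F₁ (d c) (s ∷ [])) (π₁-d (s ∷ [])) (π₂-d (s ∷ []))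

  polarity : S → Pol
  polarity s = proj₁ (d-generator-shape s)

  polarity-corresponds : Corresponds c polarity
  polarity-corresponds s = proj₂ (d-generator-shape s)

module _ {S : Set} where

  comonoid-unique : (c c′ : GrayComonoid S) (λS : S → Pol) →
    Corresponds c λS → Corresponds c′ λS → c ≐C c′
  comonoid-unique c c′ λS corr corr′ = (same-F₁ , same-F₂) , (λ u → ⊥-words-equal _ _) , (λ _ → tt)
    where
    same-F₁ : ∀ u → F₁ (d c) u ≡ F₁ (d c′) u
    same-F₁ = F₁-determined-by-generators (d c) (d c′) λ s → trans (corr s) (sym (corr′ s))

    same-F₂ : {u v : List S} (α : Perm u v) →
      Free2._≈_ (Σ[ S ] ⊠ Σ[ S ]) {F₁ (d c′) u} {F₁ (d c′) v}
        (subst₂ (Cell² S) (same-F₁ u) (same-F₁ v) (F₂ (d c) α)) (F₂ (d c′) α)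
    same-F₂ {u} {v} α =
      ≅P⇒≈P (component-subst₂-≅P {C = Cell² S} proj₁ (same-F₁ u) (same-F₁ v) _
             ⨾ proj₁-d-≅P c α ⨾ ≅P-sym (proj₁-d-≅P c′ α)) ,
      ≅P⇒≈P (component-subst₂-≅P {C = Cell² S} proj₂ (same-F₁ u) (same-F₁ v) _
             ⨾ proj₂-d-≅P c α ⨾ ≅P-sym (proj₂-d-≅P c′ α))

module Diagonal {S : Set} (D : List S → List (S ⊎ S))
  (D-[] : D [] ≡ []) (D-++ : ∀ u u′ → D (u ++ u′) ≡ D u ++ D u′)
  (π₁-D : ∀ u → π₁ (D u) ≡ u) (π₂-D : ∀ u → π₂ (D u) ≡ u) where

  diagonal₂ : {u v : List S} → Perm u v → Cell² S (D u) (D v)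
  diagonal₂ {u} {v} α = subst₂ (Free2.Cell Σ[ S ]) (sym (π₁-D u)) (sym (π₁-D v)) α ,
                        subst₂ (Free2.Cell Σ[ S ]) (sym (π₂-D u)) (sym (π₂-D v)) α

  proj₁-diagonal₂ : {u v : List S} (α : Perm u v) → proj₁ (diagonal₂ α) ≅P α
  proj₁-diagonal₂ α = subst₂-≅P

  proj₂-diagonal₂ : {u v : List S} (α : Perm u v) → proj₂ (diagonal₂ α) ≅P α
  proj₂-diagonal₂ α = subst₂-≅P

  diagonalTF : TwoFunctor Σ[ S ] (Σ[ S ] ⊠ Σ[ S ])
  diagonalTF = record
    { F₁ = D ; F₁-ε = D-[] ; F₁-· = D-++ ; F₂ = diagonal₂
    ; F₂-cong = λ {_} {_} {α} {β} e →
        ≅P⇒≈P (proj₁-diagonal₂ α ⨾ ≈P⇒≅P e ⨾ ≅P-sym (proj₁-diagonal₂ β)) ,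
        ≅P⇒≈P (proj₂-diagonal₂ α ⨾ ≈P⇒≅P e ⨾ ≅P-sym (proj₂-diagonal₂ β))
    ; F₂-id = λ u →
        ≅P⇒≈P (proj₁-diagonal₂ (idP u) ⨾ idP-≅P (sym (π₁-D u))) ,
        ≅P⇒≈P (proj₂-diagonal₂ (idP u) ⨾ idP-≅P (sym (π₂-D u)))
    ; F₂-∙ = λ α β →
        ≅P⇒≈P (proj₁-diagonal₂ (α ∙P β) ⨾ ≅P-sym (∙P-≅P (proj₁-diagonal₂ α) (proj₁-diagonal₂ β))) ,
        ≅P⇒≈P (proj₂-diagonal₂ (α ∙P β) ⨾ ≅P-sym (∙P-≅P (proj₂-diagonal₂ α) (proj₂-diagonal₂ β)))
    ; F₂-⊗ = λ {u} {v} {u′} {v′} α β →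
        ≅P⇒≈P (component-subst₂-≅P {C = Cell² S} proj₁ (D-++ u u′) (D-++ v v′) _
               ⨾ proj₁-diagonal₂ (α ⊗P β)
               ⨾ ≅P-sym (subst₂-≅P {p = sym (π₁-++ (D u) (D u′))} {sym (π₁-++ (D v) (D v′))}
                         ⨾ ⊗P-≅P (proj₁-diagonal₂ α) (proj₁-diagonal₂ β))) ,
        ≅P⇒≈P (component-subst₂-≅P {C = Cell² S} proj₂ (D-++ u u′) (D-++ v v′) _
               ⨾ proj₂-diagonal₂ (α ⊗P β)
               ⨾ ≅P-sym (subst₂-≅P {p = sym (π₂-++ (D u) (D u′))} {sym (π₂-++ (D v) (D v′))}
                         ⨾ ⊗P-≅P (proj₂-diagonal₂ α) (proj₂-diagonal₂ β)))
    }

  coassocˡ coassocʳ : Map Σ[ S ] (Σ[ S ] ⊠ (Σ[ S ] ⊠ Σ[ S ]))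
  coassocˡ = assocM {Σ[ S ]} {Σ[ S ]} {Σ[ S ]} ∘M ((diagonalTF ⊠F idTF S) ∘M toMap diagonalTF)
  coassocʳ = (idTF S ⊠F diagonalTF) ∘M toMap diagonalTF

  coassocˡ-components : {u v : List S} (α : Perm u v) →
    (proj₁ (M₂ coassocˡ α) ≅P α) × (proj₁ (proj₂ (M₂ coassocˡ α)) ≅P α) × (proj₂ (proj₂ (M₂ coassocˡ α)) ≅P α)
  coassocˡ-components {u} {v} α =
    subst₂-≅P {p = sym (r₁ (w u))} {sym (r₁ (w v))}
      ⨾ component-subst₂-≅P {C = Cell² S} proj₁ (t₁ u) (t₁ v) (diagonal₂ (proj₁ (diagonal₂ α)))
      ⨾ proj₁-diagonal₂ _ ⨾ proj₁-diagonal₂ α ,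
    subst₂-≅P {p = sym (r₂ (w u))} {sym (r₂ (w v))}
      ⨾ component-subst₂-≅P {C = Cell² S} proj₂ (t₁ u) (t₁ v) (diagonal₂ (proj₁ (diagonal₂ α)))
      ⨾ proj₂-diagonal₂ _ ⨾ proj₁-diagonal₂ α ,
    subst₂-≅P {p = sym (r₃ (w u))} {sym (r₃ (w v))}
      ⨾ subst₂-≅P {p = sym (π₂-tens diagonalTF (idTF S) (D u))} {sym (π₂-tens diagonalTF (idTF S) (D v))}
      ⨾ proj₂-diagonal₂ α
    where
    w : List S → List ((S ⊎ S) ⊎ S)
    w u = tens₁ diagonalTF (idTF S) (D u)
    t₁ : (u : List S) → D (π₁ (D u)) ≡ π₁ (w u)
    t₁ u = sym (π₁-tens diagonalTF (idTF S) (D u))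

  coassocʳ-components : {u v : List S} (α : Perm u v) →
    (proj₁ (M₂ coassocʳ α) ≅P α) × (proj₁ (proj₂ (M₂ coassocʳ α)) ≅P α) × (proj₂ (proj₂ (M₂ coassocʳ α)) ≅P α)
  coassocʳ-components {u} {v} α =
    subst₂-≅P {p = sym (π₁-tens (idTF S) diagonalTF (D u))} {sym (π₁-tens (idTF S) diagonalTF (D v))}
      ⨾ proj₁-diagonal₂ α ,
    component-subst₂-≅P {C = Cell² S} proj₁ (t₂ u) (t₂ v) (diagonal₂ (proj₂ (diagonal₂ α)))
      ⨾ proj₁-diagonal₂ _ ⨾ proj₂-diagonal₂ α ,
    component-subst₂-≅P {C = Cell² S} proj₂ (t₂ u) (t₂ v) (diagonal₂ (proj₂ (diagonal₂ α)))
      ⨾ proj₂-diagonal₂ _ ⨾ proj₂-diagonal₂ α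
    where
    t₂ : (u : List S) → D (π₂ (D u)) ≡ π₂ (tens₁ (idTF S) diagonalTF (D u))
    t₂ u = sym (π₂-tens (idTF S) diagonalTF (D u))

  counitˡ-cell : {u v : List S} (α : Perm u v) →
    M₂ (unitˡ {Σ[ S ]} ∘M ((terminalTF {Σ[ S ]} ⊠F idTF S) ∘M toMap diagonalTF)) α ≅P α
  counitˡ-cell {u} {v} α =
    subst₂-≅P {p = sym (π₂-tens terminalTF (idTF S) (D u))} {sym (π₂-tens terminalTF (idTF S) (D v))}
      ⨾ proj₂-diagonal₂ α

  counitʳ-cell : {u v : List S} (α : Perm u v) →
    M₂ (unitʳ {Σ[ S ]} ∘M ((idTF S ⊠F terminalTF {Σ[ S ]}) ∘M toMap diagonalTF)) α ≅P α
  counitʳ-cell {u} {v} α =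
    subst₂-≅P {p = sym (π₁-tens (idTF S) terminalTF (D u))} {sym (π₁-tens (idTF S) terminalTF (D v))}
      ⨾ proj₁-diagonal₂ α

  diagonalComonoid :
    (∀ u → map reassoc (tens₁ diagonalTF (idTF S) (D u)) ≡ tens₁ (idTF S) diagonalTF (D u)) → GrayComonoid S
  diagonalComonoid coassoc₁ = record
    { d = diagonalTF ; e = terminalTF
    ; coassoc = coassoc₁ , λ {u} {v} α →
        let (l₁ , l₂ , l₃) = coassocˡ-components α
            (r₁ , r₂ , r₃) = coassocʳ-components α
            lhs : C₃ (M₁ coassocˡ u) (M₁ coassocˡ v)
            lhs = M₂ coassocˡ α
        in ≅P⇒≈P (component-subst₂-≅P {C = C₃} proj₁ (coassoc₁ u) (coassoc₁ v) lhs ⨾ l₁ ⨾ ≅P-sym r₁) ,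
           ≅P⇒≈P (component-subst₂-≅P {C = C₃} (proj₁ ∘ proj₂) (coassoc₁ u) (coassoc₁ v) lhs ⨾ l₂ ⨾ ≅P-sym r₂) ,
           ≅P⇒≈P (component-subst₂-≅P {C = C₃} (proj₂ ∘ proj₂) (coassoc₁ u) (coassoc₁ v) lhs ⨾ l₃ ⨾ ≅P-sym r₃)
    ; counitˡ = counitˡ₁ , λ {u} {v} α → ≅P⇒≈P (subst₂-≅P {p = counitˡ₁ u} {counitˡ₁ v} ⨾ counitˡ-cell α)
    ; counitʳ = counitʳ₁ , λ {u} {v} α → ≅P⇒≈P (subst₂-≅P {p = counitʳ₁ u} {counitʳ₁ v} ⨾ counitʳ-cell α)
    }
    where
    C₃ : List (S ⊎ (S ⊎ S)) → List (S ⊎ (S ⊎ S)) → Set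
    C₃ = Free2.Cell (Σ[ S ] ⊠ (Σ[ S ] ⊠ Σ[ S ]))
    counitˡ₁ : ∀ u → π₂ (tens₁ terminalTF (idTF S) (D u)) ≡ u
    counitˡ₁ u = trans (π₂-tens terminalTF (idTF S) (D u)) (π₂-D u)
    counitʳ₁ : ∀ u → π₁ (tens₁ (idTF S) terminalTF (D u)) ≡ u
    counitʳ₁ u = trans (π₁-tens (idTF S) terminalTF (D u)) (π₁-D u)

module _ {S : Set} (λS : S → Pol) where

  polarityWord : List S → List (S ⊎ S)
  polarityWord []      = []
  polarityWord (s ∷ u) = polGen (λS s) s ++ polarityWord u

  polarityWord-++ : ∀ u u′ → polarityWord (u ++ u′) ≡ polarityWord u ++ polarityWord u′
  polarityWord-++ []      u′ = refl
  polarityWord-++ (s ∷ u) u′ = trans (cong (polGen (λS s) s ++_) (polarityWord-++ u u′))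
                                     (sym (++-assoc (polGen (λS s) s) (polarityWord u) (polarityWord u′)))

  π₁-polarityWord : ∀ u → π₁ (polarityWord u) ≡ u
  π₁-polarityWord []      = refl
  π₁-polarityWord (s ∷ u) = trans (π₁-polGen-++ (λS s) s (polarityWord u)) (cong (s ∷_) (π₁-polarityWord u))

  π₂-polarityWord : ∀ u → π₂ (polarityWord u) ≡ u
  π₂-polarityWord []      = refl
  π₂-polarityWord (s ∷ u) = trans (π₂-polGen-++ (λS s) s (polarityWord u)) (cong (s ∷_) (π₂-polarityWord u))

  open Diagonal polarityWord refl polarityWord-++ π₁-polarityWord π₂-polarityWord

  polarityWord-coassociative : ∀ u →
    map reassoc (tens₁ diagonalTF (idTF S) (polarityWord u)) ≡ tens₁ (idTF S) diagonalTF (polarityWord u)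
  polarityWord-coassociative []      = refl
  polarityWord-coassociative (s ∷ u) = begin
    map reassoc (tens₁ Δ id (polGen (λS s) s ++ polarityWord u))
      ≡⟨ cong (map reassoc) (tens₁-++ Δ id (polGen (λS s) s) (polarityWord u)) ⟩
    map reassoc (tens₁ Δ id (polGen (λS s) s) ++ tens₁ Δ id (polarityWord u))
      ≡⟨ map-++ reassoc (tens₁ Δ id (polGen (λS s) s)) (tens₁ Δ id (polarityWord u)) ⟩
    map reassoc (tens₁ Δ id (polGen (λS s) s)) ++ map reassoc (tens₁ Δ id (polarityWord u))
      ≡⟨ cong₂ _++_ (generator (λS s) refl) (polarityWord-coassociative u) ⟩
    tens₁ id Δ (polGen (λS s) s) ++ tens₁ id Δ (polarityWord u)
      ≡⟨ tens₁-++ id Δ (polGen (λS s) s) (polarityWord u) ⟨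
    tens₁ id Δ (polGen (λS s) s ++ polarityWord u)
      ∎
    where
    open ≡-Reasoning
    Δ : TwoFunctor Σ[ S ] (Σ[ S ] ⊠ Σ[ S ])
    Δ = diagonalTF
    id : TwoFunctor Σ[ S ] Σ[ S ]
    id = idTF S
    -- Abstracting λS s to p lets both sides compute to the same three-letter word.
    generator : (p : Pol) → λS s ≡ p → map reassoc (tens₁ Δ id (polGen p s)) ≡ tens₁ id Δ (polGen p s)
    generator O eq rewrite eq = refl
    generator P eq rewrite eq = refl

  polarityComonoid : GrayComonoid S
  polarityComonoid = diagonalComonoid polarityWord-coassociative

  polarityComonoid-corresponds : Corresponds polarityComonoid λS
  polarityComonoid-corresponds s = ++-identityʳ (polGen (λS s) s)

mainTheorem3 : (S : Set) →
    ((λS : S → Pol) → Σ (GrayComonoid S) (λ c → Corresponds c λS))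
    × ((c : GrayComonoid S) → Σ (S → Pol) (λ λS → Corresponds c λS))
    × ((c c' : GrayComonoid S) (λS : S → Pol) → Corresponds c λS → Corresponds c' λS → c ≐C c')
    × ((c : GrayComonoid S) (λS λS' : S → Pol) → Corresponds c λS → Corresponds c λS' → (s : S) → λS s ≡ λS' s)
mainTheorem3 S =
  (λ λS → polarityComonoid λS , polarityComonoid-corresponds λS) ,
  (λ c → polarity c , polarity-corresponds c) ,
  comonoid-unique ,
  λ c λS λS′ corr corr′ s → polGen-injective (trans (sym (corr s)) (corr′ s))
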